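{- If a graph $G=(V,E)$ has a proper MPTG representation $S$, then $G$ has a proper MPTG representation $T=\{(I_v,p_v):v\in V\}$ in which the points $p_v$, $v\in V$, are pairwise distinct.
   Context: For a finite simple undirected graph $G=(V,E)$, an MPTG representation is an assignment to each vertex $u$ of a pair $(I_u,p_u)$, with $I_u$ a closed bounded real interval and $p_u\in I_u$, such that for distinct $u,v$, $uv\in E$ iff $\{p_u,p_v\}\subseteq I_u\cap I_v$. It is a proper MPTG representation if no interval $I_u$ properly contains another interval $I_v$.
   Formalization: The intervals $I_u$ have rational endpoints and the points $p_u$ are rational, rather than real, for both the given and the resulting representation. -}

module Defs where

open import Level using (0ℓ)
open import Data.Nat using (ℕ)
open import Data.Fin using (Fin)
open import Data.Rational using (ℚ; _≤_)
open import Data.Product using (_×_; Σ)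
open import Relation.Nullary using (¬_)
open import Relation.Binary.PropositionalEquality using (_≡_; _≢_)
open import Function.Bundles using (_⇔_)

record Graph (n : ℕ) : Set₁ where
  field
    Adj    : Fin n → Fin n → Set
    sym    : ∀ {u v} → Adj u v → Adj v u
    irrefl : ∀ {u} → ¬ Adj u u

record Interval : Set where
  constructor [_,_]⟨_⟩
  field
    lo   : ℚ
    hi   : ℚ
    lo≤hi : lo ≤ hi
open Interval public

_∈ᴵ_ : ℚ → Interval → Set
x ∈ᴵ I = (lo I ≤ x) × (x ≤ hi I)

_⊆ᴵ_ : Interval → Interval → Set
I ⊆ᴵ J = ∀ x → x ∈ᴵ I → x ∈ᴵ J

_⊊ᴵ_ : Interval → Interval → Set
I ⊊ᴵ J = (I ⊆ᴵ J) × ¬ (J ⊆ᴵ I)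

record Assignment (n : ℕ) : Set where
  field
    I     : Fin n → Interval
    p     : Fin n → ℚ
    p∈I   : ∀ u → p u ∈ᴵ I u
open Assignment public

IsMPTGRep : ∀ {n} → Graph n → Assignment n → Set
IsMPTGRep G S = ∀ u v → u ≢ v →
  Graph.Adj G u v ⇔
    ((p S u ∈ᴵ I S u × p S u ∈ᴵ I S v) × (p S v ∈ᴵ I S u × p S v ∈ᴵ I S v))

IsProper : ∀ {n} → Assignment n → Set
IsProper S = ∀ u v → ¬ (I S u ⊊ᴵ I S v)

IsProperMPTGRep : ∀ {n} → Graph n → Assignment n → Set
IsProperMPTGRep G S = IsMPTGRep G S × IsProper S

DistinctPoints : ∀ {n} → Assignment n → Set
DistinctPoints S = ∀ u v → p S u ≡ p S v → u ≡ v

{-# OPTIONS --safe #-}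
module Submission where

-- Replace every coordinate x of S by (n + 2) · rank x + offset, where rank x counts the
-- coordinates of S strictly below x and the offset breaks ties: 0 for left endpoints, u + 1 for
-- the point p_u, n + 1 for right endpoints.  Membership p_u ∈ I_v only compares a left
-- endpoint with a point and a point with a right endpoint, and containment of intervals
-- only compares endpoints of the same side; in each of these comparisons the offset of
-- the smaller side is at most that of the larger, so the new coordinates preserve and
-- reflect all of them.  The points now differ in their offsets.

open import Defs
open import Data.Nat using (ℕ)
open import Data.Product using (Σ; _×_)

open import Data.Nat as ℕ using (suc; _+_; _*_; z≤n; s≤s)
import Data.Nat.Properties as ℕ
open import Data.Fin using (Fin; toℕ)
import Data.Fin.Properties as Fin
open import Data.Integer as ℤ using (+_; +≤+)
import Data.Integer.Properties as ℤ
open import Data.Rational as ℚ using (ℚ; *≤*)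
open import Data.Rational.Literals using (fromℤ)
open import Data.Rational.Properties as ℚ using (_<?_)
open import Data.List using (List; []; _∷_; _++_; map; allFin)
open import Data.List.Membership.Propositional using (_∈_)
open import Data.List.Membership.Propositional.Properties using (∈-map⁺; ∈-++⁺ˡ; ∈-++⁺ʳ; ∈-allFin)
open import Data.List.Relation.Unary.Any using (here; there)
open import Data.Product using (_,_; proj₁; proj₂)
open import Data.Product.Function.NonDependent.Propositional using (_×-⇔_)
open import Function using (_∘_)
open import Function.Bundles using (_⇔_; mk⇔; Equivalence)
open import Function.Construct.Composition using (_⇔-∘_)
open import Function.Construct.Symmetry using (⇔-sym)
open import Relation.Nullary using (yes; no; contradiction)
open import Relation.Binary.PropositionalEquality using (_≡_; refl; sym; trans; cong; subst₂)

fromℕ : ℕ → ℚ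
fromℕ m = fromℤ (+ m)

fromℕ-mono-≤ : ∀ {m n} → m ℕ.≤ n → fromℕ m ℚ.≤ fromℕ n
fromℕ-mono-≤ m≤n = *≤* (subst₂ ℤ._≤_ (sym (ℤ.*-identityʳ _)) (sym (ℤ.*-identityʳ _)) (+≤+ m≤n))

fromℕ-cancel-≤ : ∀ {m n} → fromℕ m ℚ.≤ fromℕ n → m ℕ.≤ n
fromℕ-cancel-≤ (*≤* m≤n) = ℤ.drop‿+≤+ (subst₂ ℤ._≤_ (ℤ.*-identityʳ _) (ℤ.*-identityʳ _) m≤n)

fromℕ-injective : ∀ {m n} → fromℕ m ≡ fromℕ n → m ≡ n
fromℕ-injective = cong (ℤ.∣_∣ ∘ ℚ.↥_)

rank : List ℚ → ℚ → ℕ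
rank []       x = 0
rank (y ∷ ys) x with y <? x
... | yes _ = suc (rank ys x)
... | no  _ = rank ys x

rank-mono-≤ : ∀ xs {x y} → x ℚ.≤ y → rank xs x ℕ.≤ rank xs y
rank-mono-≤ []       x≤y = z≤n
rank-mono-≤ (z ∷ zs) {x} {y} x≤y with z <? x | z <? y
... | yes _   | yes _   = s≤s (rank-mono-≤ zs x≤y)
... | yes z<x | no  z≮y = contradiction (ℚ.<-≤-trans z<x x≤y) z≮y
... | no  _   | yes _   = ℕ.m≤n⇒m≤1+n (rank-mono-≤ zs x≤y)
... | no  _   | no  _   = rank-mono-≤ zs x≤y

rank-<-∈ : ∀ {xs a x} → a ∈ xs → a ℚ.< x → rank xs a ℕ.< rank xs x
rank-<-∈ {a ∷ zs} {x = x} (here refl) a<x with a <? a | a <? x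
... | yes a<a | _       = contradiction a<a (ℚ.<-irrefl refl)
... | no  _   | yes _   = s≤s (rank-mono-≤ zs (ℚ.<⇒≤ a<x))
... | no  _   | no  a≮x = contradiction a<x a≮x
rank-<-∈ {z ∷ zs} {a} {x} (there a∈zs) a<x with z <? a | z <? x
... | yes _   | yes _   = s≤s (rank-<-∈ a∈zs a<x)
... | yes z<a | no  z≮x = contradiction (ℚ.<-trans z<a a<x) z≮x
... | no  _   | yes _   = ℕ.m<n⇒m<1+n (rank-<-∈ a∈zs a<x)
... | no  _   | no  _   = rank-<-∈ a∈zs a<x

rank-cancel-≤ : ∀ {xs a b} → b ∈ xs → rank xs a ℕ.≤ rank xs b → a ℚ.≤ b
rank-cancel-≤ {a = a} {b} b∈xs ra≤rb with b <? a
... | yes b<a = contradiction ra≤rb (ℕ.<⇒≱ (rank-<-∈ b∈xs b<a))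
... | no  b≮a = ℚ.≮⇒≥ b≮a

*+-mono-≤ : ∀ M {a b s t} → a ℕ.≤ b → s ℕ.≤ t → suc M * a + s ℕ.≤ suc M * b + t
*+-mono-≤ M a≤b s≤t = ℕ.+-mono-≤ (ℕ.*-monoʳ-≤ (suc M) a≤b) s≤t

*+-cancel-≤ : ∀ M {a b s t} → t ℕ.≤ M → suc M * a + s ℕ.≤ suc M * b + t → a ℕ.≤ b
*+-cancel-≤ M {a} {b} {s} {t} t≤M le with a ℕ.≤? b
... | yes a≤b = a≤b
... | no  a≰b = contradiction le (ℕ.<⇒≱ (begin-strict
    suc M * b + t      ≤⟨ ℕ.+-monoʳ-≤ (suc M * b) t≤M ⟩
    suc M * b + M      <⟨ ℕ.+-monoʳ-< (suc M * b) (ℕ.n<1+n M) ⟩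
    suc M * b + suc M  ≡⟨ ℕ.+-comm (suc M * b) (suc M) ⟩
    suc M + suc M * b  ≡⟨ ℕ.*-suc (suc M) b ⟨
    suc M * suc b      ≤⟨ ℕ.*-monoʳ-≤ (suc M) (ℕ.≰⇒> a≰b) ⟩
    suc M * a          ≤⟨ ℕ.m≤m+n (suc M * a) s ⟩
    suc M * a + s      ∎))
  where open ℕ.≤-Reasoning

*+-injectiveʳ : ∀ M {a b s t} → s ℕ.≤ M → t ℕ.≤ M → suc M * a + s ≡ suc M * b + t → s ≡ t
*+-injectiveʳ M {a} {b} {s} {t} s≤M t≤M eq =
  ℕ.+-cancelˡ-≡ (suc M * a) s t (trans eq (cong (λ c → suc M * c + t) (sym a≡b)))
  where
  a≡b : a ≡ b
  a≡b = ℕ.≤-antisym (*+-cancel-≤ M t≤M (ℕ.≤-reflexive eq))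
                    (*+-cancel-≤ M s≤M (ℕ.≤-reflexive (sym eq)))

⊆ᴵ⇔ : ∀ {I J} → I ⊆ᴵ J ⇔ (lo J ℚ.≤ lo I × hi I ℚ.≤ hi J)
⊆ᴵ⇔ {I} {J} = mk⇔
  (λ I⊆J → proj₁ (I⊆J (lo I) (ℚ.≤-refl , lo≤hi I)) , proj₂ (I⊆J (hi I) (lo≤hi I , ℚ.≤-refl)))
  (λ (lo≤lo , hi≤hi) x (lo≤x , x≤hi) → ℚ.≤-trans lo≤lo lo≤x , ℚ.≤-trans x≤hi hi≤hi)

module _ {n} {S T : Assignment n} where

  isMPTGRep-transport : ∀ {G : Graph n} → (∀ u v → p S u ∈ᴵ I S v ⇔ p T u ∈ᴵ I T v) →
                        IsMPTGRep G S → IsMPTGRep G T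
  isMPTGRep-transport ∈⇔ rep u v u≢v =
    ((∈⇔ u u ×-⇔ ∈⇔ u v) ×-⇔ (∈⇔ v u ×-⇔ ∈⇔ v v)) ⇔-∘ rep u v u≢v

  isProper-transport : (∀ u v → I S u ⊆ᴵ I S v ⇔ I T u ⊆ᴵ I T v) →
                       IsProper S → IsProper T
  isProper-transport ⊆⇔ proper u v (u⊆v , v⊈u) =
    proper u v (Equivalence.from (⊆⇔ u v) u⊆v , v⊈u ∘ Equivalence.to (⊆⇔ v u))

module Separation {n} (S : Assignment n) where

  coordinates : List ℚ
  coordinates = map (lo ∘ I S) (allFin n) ++ map (p S) (allFin n) ++ map (hi ∘ I S) (allFin n)

  lo∈coordinates : ∀ v → lo (I S v) ∈ coordinates
  lo∈coordinates v = ∈-++⁺ˡ (∈-map⁺ (lo ∘ I S) (∈-allFin v))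

  p∈coordinates : ∀ u → p S u ∈ coordinates
  p∈coordinates u = ∈-++⁺ʳ (map (lo ∘ I S) (allFin n)) (∈-++⁺ˡ (∈-map⁺ (p S) (∈-allFin u)))

  hi∈coordinates : ∀ v → hi (I S v) ∈ coordinates
  hi∈coordinates v = ∈-++⁺ʳ (map (lo ∘ I S) (allFin n))
                       (∈-++⁺ʳ (map (p S) (allFin n)) (∈-map⁺ (hi ∘ I S) (∈-allFin v)))

  relocate : ℚ → ℕ → ℚ
  relocate x offset = fromℕ (suc (suc n) * rank coordinates x + offset)

  relocate-≤⇔ : ∀ {x y d e} → y ∈ coordinates → d ℕ.≤ e → e ℕ.≤ suc n →
                x ℚ.≤ y ⇔ relocate x d ℚ.≤ relocate y e
  relocate-≤⇔ y∈ d≤e e≤1+n = mk⇔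
    (λ x≤y → fromℕ-mono-≤ (*+-mono-≤ (suc n) (rank-mono-≤ coordinates x≤y) d≤e))
    (λ x′≤y′ → rank-cancel-≤ y∈ (*+-cancel-≤ (suc n) e≤1+n (fromℕ-cancel-≤ x′≤y′)))

  1+toℕ≤1+n : ∀ (u : Fin n) → suc (toℕ u) ℕ.≤ suc n
  1+toℕ≤1+n u = ℕ.m≤n⇒m≤1+n (Fin.toℕ<n u)

  interval′ : Fin n → Interval
  interval′ v = [ relocate (lo (I S v)) 0 , relocate (hi (I S v)) (suc n) ]⟨
    Equivalence.to (relocate-≤⇔ (hi∈coordinates v) z≤n ℕ.≤-refl) (lo≤hi (I S v)) ⟩

  point′ : Fin n → ℚ
  point′ u = relocate (p S u) (suc (toℕ u))

  separated-∈ᴵ⇔ : ∀ u v → p S u ∈ᴵ I S v ⇔ point′ u ∈ᴵ interval′ v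
  separated-∈ᴵ⇔ u v = relocate-≤⇔ (p∈coordinates u) z≤n (1+toℕ≤1+n u)
       ×-⇔ relocate-≤⇔ (hi∈coordinates v) (1+toℕ≤1+n u) ℕ.≤-refl

  separated-⊆ᴵ⇔ : ∀ u v → I S u ⊆ᴵ I S v ⇔ interval′ u ⊆ᴵ interval′ v
  separated-⊆ᴵ⇔ u v = ⇔-sym (⊆ᴵ⇔ {interval′ u} {interval′ v})
    ⇔-∘ ((relocate-≤⇔ (lo∈coordinates u) z≤n z≤n
          ×-⇔ relocate-≤⇔ (hi∈coordinates v) ℕ.≤-refl ℕ.≤-refl)
         ⇔-∘ ⊆ᴵ⇔ {I S u} {I S v})

  separated : Assignment n
  separated = record
    { I   = interval′
    ; p   = point′
    ; p∈I = λ u → Equivalence.to (separated-∈ᴵ⇔ u u) (p∈I S u)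
    }

  separated-isProperMPTGRep : ∀ {G} → IsProperMPTGRep G S → IsProperMPTGRep G separated
  separated-isProperMPTGRep {G} (rep , proper) =
    isMPTGRep-transport {S = S} {separated} {G} separated-∈ᴵ⇔ rep ,
    isProper-transport {S = S} {separated} separated-⊆ᴵ⇔ proper

  separated-distinct : DistinctPoints separated
  separated-distinct u v eq = Fin.toℕ-injective (ℕ.suc-injective
    (*+-injectiveʳ (suc n) {rank coordinates (p S u)} {rank coordinates (p S v)}
                   (1+toℕ≤1+n u) (1+toℕ≤1+n v) (fromℕ-injective eq)))

proposition3p1 : (n : ℕ) (G : Graph n) →
    Σ (Assignment n) (λ S → IsProperMPTGRep G S) →
    Σ (Assignment n) (λ T → IsProperMPTGRep G T × DistinctPoints T)
proposition3p1 n G (S , S-rep) = separated , separated-isProperMPTGRep {G} S-rep , separated-distinct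
  where open Separation S
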